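{- Let $G$ be a graph containing a perfect matching $M$, and let $W$ be a shifted $M$-walk in $G$ with endpoints $a$ and $b$. Then $W$ contains a simple shifted $M$-walk $W'$ with endpoints $a$ and $b$.
   Context: For a graph $G$ with perfect matching $M$, a shifted $M$-walk with endpoints $a=v_1$ and $b=v_{2\ell}$ is a walk $v_1 v_2 \dots v_{2\ell}$ in $G$ such that $v_{2i}v_{2i+1} \in M$ for every $1 \le i \le \ell-1$ and $v_{2i-1}v_{2i} \notin M$ for every $1 \le i \le \ell$. A shifted $M$-walk is simple if it contains each edge of $M$ at most twice. -}

module Defs where

open import Data.Nat using (ℕ; zero; suc; _≤_)
open import Data.Fin using (Fin; _≟_)
open import Data.Bool using (Bool; true; false; _∧_; _∨_; if_then_else_)
open import Data.List using (List; []; _∷_)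
open import Data.Product using (Σ; _×_; _,_)
open import Data.Sum using (_⊎_)
open import Relation.Nullary using (¬_; does)
open import Relation.Binary.PropositionalEquality using (_≡_)
open import Data.List.Membership.Propositional using (_∈_)

record Graph (n : ℕ) : Set₁ where
  field
    Adj    : Fin n → Fin n → Set
    sym    : ∀ {u v} → Adj u v → Adj v u
    irrefl : ∀ {v} → ¬ Adj v v

record PerfectMatching {n : ℕ} (G : Graph n) : Set₁ where
  open Graph G
  field
    M       : Fin n → Fin n → Set
    M-sym   : ∀ {u v} → M u v → M v u
    M⊆E     : ∀ {u v} → M u v → Adj u v
    perfect : ∀ v → Σ (Fin n) (λ u → M v u × (∀ w → M v w → w ≡ u))

-- A shifted M-walk v1 v2 ... v_{2l} is encoded by the list of its
-- non-matching steps (v1,v2), (v3,v4), ..., (v_{2l-1},v_{2l}).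
data ShiftedWalk {n : ℕ} (G : Graph n) (PM : PerfectMatching G)
       : Fin n → Fin n → List (Fin n × Fin n) → Set where
  last : ∀ {a b} → Graph.Adj G a b → ¬ PerfectMatching.M PM a b →
         ShiftedWalk G PM a b ((a , b) ∷ [])
  step : ∀ {a c d b W} → Graph.Adj G a c → ¬ PerfectMatching.M PM a c →
         PerfectMatching.M PM c d → ShiftedWalk G PM d b W →
         ShiftedWalk G PM a b ((a , c) ∷ W)

vertices : {n : ℕ} → List (Fin n × Fin n) → List (Fin n)
vertices []              = []
vertices ((x , y) ∷ W) = x ∷ y ∷ vertices W

steps : {n : ℕ} → List (Fin n) → List (Fin n × Fin n)
steps []           = []
steps (x ∷ [])     = []
steps (x ∷ y ∷ vs) = (x , y) ∷ steps (y ∷ vs)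

walkEdges : {n : ℕ} → List (Fin n × Fin n) → List (Fin n × Fin n)
walkEdges W = steps (vertices W)

occurrences : {n : ℕ} → Fin n → Fin n → List (Fin n × Fin n) → ℕ
occurrences u v [] = 0
occurrences u v ((x , y) ∷ es) =
  if (does (x ≟ u) ∧ does (y ≟ v)) ∨ (does (x ≟ v) ∧ does (y ≟ u))
  then suc (occurrences u v es) else occurrences u v es

Simple : {n : ℕ} {G : Graph n} → PerfectMatching G → List (Fin n × Fin n) → Set
Simple PM W = ∀ u v → PerfectMatching.M PM u v → occurrences u v (walkEdges W) ≤ 2

_⊑_ : {n : ℕ} → List (Fin n × Fin n) → List (Fin n × Fin n) → Set
W' ⊑ W = ∀ x y → (x , y) ∈ walkEdges W' →
         ((x , y) ∈ walkEdges W) ⊎ ((y , x) ∈ walkEdges W)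

module Submission where

-- A shifted M-walk  v₁ v₂ … v₂ₗ  is encoded by its non-matching steps
-- (v₁,v₂), (v₃,v₄), …; call v₁, v₃, v₅, … its *starts* and v₃, v₅, … its
-- *re-entries* (the vertices reached through a matching edge).
--
-- Every traversal of a matching edge {u,v} is a matching step
-- (v₂ᵢ, v₂ᵢ₊₁), and it ends at a re-entry equal to u or v.  Hence the number
-- of traversals of {u,v} is at most (multiplicity of u among the re-entries)
-- + (multiplicity of v among the re-entries)  [occurrences-≤-reentries].
-- So a walk whose starts are pairwise distinct is simple [distinctStarts⇒Simple].
-- Any shifted walk can be shortcut to one with distinct starts using only
-- its own edges [shortcut]: shortcut the tail recursively and, if the first
-- vertex a reappears as a later start, jump to the suffix beginning there
-- [suffixFrom]; this suffix is again a shifted walk from a to b.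

open import Defs
open import Data.Fin using (Fin; _≟_)
open import Data.List using (List; []; _∷_)
open import Data.List.Relation.Binary.Subset.Propositional using (_⊆_)
open import Data.List.Relation.Binary.Subset.Propositional.Properties
  using (⊆-refl; ⊆-trans; xs⊆x∷xs; ∷⁺ʳ)
open import Data.Product using (Σ; _×_; _,_)
open import Data.Nat using (ℕ; zero; suc; _≤_; _<_; _+_; z≤n; s≤s)
open import Data.Nat.Properties
  using (≤-refl; ≤-trans; n≤1+n; +-suc; +-monoʳ-≤; +-mono-≤; module ≤-Reasoning)
open import Data.Bool using (true; false; _∧_; _∨_; if_then_else_)
open import Data.Sum using (_⊎_; inj₁; inj₂)
open import Relation.Nullary using (Dec; does; yes; no; ¬_; contradiction)
open import Relation.Binary.PropositionalEquality
  using (_≡_; _≢_; refl; sym; cong; cong₂; subst; subst₂)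

starts : ∀ {n} → List (Fin n × Fin n) → List (Fin n)
starts []            = []
starts ((x , _) ∷ W) = x ∷ starts W

reentries : ∀ {n} → List (Fin n × Fin n) → List (Fin n)
reentries []      = []
reentries (_ ∷ W) = starts W

multiplicity : ∀ {n} → Fin n → List (Fin n) → ℕ
multiplicity x []       = 0
multiplicity x (y ∷ ys) = if does (y ≟ x) then suc (multiplicity x ys) else multiplicity x ys

DistinctStarts : ∀ {n} → List (Fin n × Fin n) → Set
DistinctStarts W = ∀ x → multiplicity x (starts W) ≤ 1

multiplicity-∷ : ∀ {n} (x y : Fin n) ys → multiplicity x ys ≤ multiplicity x (y ∷ ys)
multiplicity-∷ x y ys with does (y ≟ x)
... | true  = n≤1+n _
... | false = ≤-refl

multiplicity-head : ∀ {n} (x : Fin n) ys → multiplicity x (x ∷ ys) ≡ suc (multiplicity x ys)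
multiplicity-head x ys with x ≟ x
... | yes _   = refl
... | no x≢x = contradiction refl x≢x

multiplicity-other : ∀ {n} {x y : Fin n} ys → y ≢ x → multiplicity x (y ∷ ys) ≡ multiplicity x ys
multiplicity-other {x = x} {y} ys y≢x with y ≟ x
... | yes y≡x = contradiction y≡x y≢x
... | no _    = refl

atMostOnce-∷ : ∀ {n} (a : Fin n) ys → multiplicity a ys ≡ 0 →
               (∀ x → multiplicity x ys ≤ 1) → ∀ x → multiplicity x (a ∷ ys) ≤ 1
atMostOnce-∷ a ys a∉ys once x with a ≟ x
... | yes refl = subst (λ k → suc k ≤ 1) (sym a∉ys) ≤-refl
... | no _     = once x

reentries≤starts : ∀ {n} (x : Fin n) W → multiplicity x (reentries W) ≤ multiplicity x (starts W)
reentries≤starts x []            = ≤-refl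
reentries≤starts x ((y , _) ∷ W) = multiplicity-∷ x y (starts W)

Traverses : ∀ {n} → Fin n × Fin n → Fin n → Fin n → Set
Traverses (x , y) u v = (x ≡ u × y ≡ v) ⊎ (x ≡ v × y ≡ u)

occurrences-other : ∀ {n} {u v x y : Fin n} es → ¬ Traverses (x , y) u v →
                    occurrences u v ((x , y) ∷ es) ≡ occurrences u v es
occurrences-other {u = u} {v} {x} {y} es ¬t with x ≟ u | y ≟ v | x ≟ v | y ≟ u
... | yes x≡u | yes y≡v | _       | _       = contradiction (inj₁ (x≡u , y≡v)) ¬t
... | _       | _       | yes x≡v | yes y≡u = contradiction (inj₂ (x≡v , y≡u)) ¬t
... | yes _   | no _    | yes _   | no _    = refl
... | yes _   | no _    | no _    | _       = refl
... | no _    | _       | yes _   | no _    = refl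
... | no _    | _       | no _    | _       = refl

occurrences-∷-≤ : ∀ {n} (u v : Fin n) e es → occurrences u v (e ∷ es) ≤ suc (occurrences u v es)
occurrences-∷-≤ u v (x , y) es with (does (x ≟ u) ∧ does (y ≟ v)) ∨ (does (x ≟ v) ∧ does (y ≟ u))
... | true  = ≤-refl
... | false = n≤1+n _

-- A step (x , y) traversing {u,v} ends at u or v, so it is paid for by
-- recording its endpoint y.  The comparisons of y with u and v are taken as
-- arguments rather than split by 'with', so that the multiplicity lemmas
-- apply to the goal as stated.
occurrences-≤-endpoints : ∀ {n} {u v x y : Fin n} {es ys} → Dec (y ≡ u) → Dec (y ≡ v) →
  occurrences u v es ≤ multiplicity u ys + multiplicity v ys →
  occurrences u v ((x , y) ∷ es) ≤ multiplicity u (y ∷ ys) + multiplicity v (y ∷ ys)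
occurrences-≤-endpoints {u = u} {v} {x} {es = es} {ys} (yes refl) _ bound = begin
  occurrences u v ((x , u) ∷ es)                 ≤⟨ occurrences-∷-≤ u v (x , u) es ⟩
  suc (occurrences u v es)                       ≤⟨ s≤s bound ⟩
  suc (multiplicity u ys + multiplicity v ys)    ≤⟨ s≤s (+-monoʳ-≤ _ (multiplicity-∷ v u ys)) ⟩
  suc (multiplicity u ys + multiplicity v (u ∷ ys))
    ≡⟨ cong (_+ multiplicity v (u ∷ ys)) (sym (multiplicity-head u ys)) ⟩
  multiplicity u (u ∷ ys) + multiplicity v (u ∷ ys) ∎
  where open ≤-Reasoning
occurrences-≤-endpoints {u = u} {v} {x} {es = es} {ys} (no v≢u) (yes refl) bound = begin
  occurrences u v ((x , v) ∷ es)                 ≤⟨ occurrences-∷-≤ u v (x , v) es ⟩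
  suc (occurrences u v es)                       ≤⟨ s≤s bound ⟩
  suc (multiplicity u ys + multiplicity v ys)    ≡⟨ sym (+-suc _ _) ⟩
  multiplicity u ys + suc (multiplicity v ys)
    ≡⟨ sym (cong₂ _+_ (multiplicity-other ys v≢u) (multiplicity-head v ys)) ⟩
  multiplicity u (v ∷ ys) + multiplicity v (v ∷ ys) ∎
  where open ≤-Reasoning
occurrences-≤-endpoints {u = u} {v} {x} {y} {es} {ys} (no y≢u) (no y≢v) bound = begin
  occurrences u v ((x , y) ∷ es)                 ≡⟨ occurrences-other es ¬traverses ⟩
  occurrences u v es                             ≤⟨ bound ⟩
  multiplicity u ys + multiplicity v ys
    ≡⟨ sym (cong₂ _+_ (multiplicity-other ys y≢u) (multiplicity-other ys y≢v)) ⟩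
  multiplicity u (y ∷ ys) + multiplicity v (y ∷ ys) ∎
  where
  open ≤-Reasoning
  ¬traverses : ¬ Traverses (x , y) u v
  ¬traverses (inj₁ (_ , y≡v)) = y≢v y≡v
  ¬traverses (inj₂ (_ , y≡u)) = y≢u y≡u

module _ {n} {G : Graph n} {PM : PerfectMatching G} where
  open PerfectMatching PM

  nonMatching-¬Traverses : ∀ {x y u v} → ¬ M x y → M u v → ¬ Traverses (x , y) u v
  nonMatching-¬Traverses ¬mxy muv (inj₁ (refl , refl)) = ¬mxy muv
  nonMatching-¬Traverses ¬mxy muv (inj₂ (refl , refl)) = ¬mxy (M-sym muv)

  walkEdges-∷ : ∀ {a c d b V} → ShiftedWalk G PM d b V →
                walkEdges ((a , c) ∷ V) ≡ (a , c) ∷ (c , d) ∷ walkEdges V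
  walkEdges-∷ (last _ _)     = refl
  walkEdges-∷ (step _ _ _ _) = refl

  starts-walk : ∀ {d b V} → ShiftedWalk G PM d b V → starts V ≡ d ∷ reentries V
  starts-walk (last _ _)     = refl
  starts-walk (step _ _ _ _) = refl

  walkEdges-tail-⊆ : ∀ {a c d b V} → ShiftedWalk G PM d b V →
                     walkEdges V ⊆ walkEdges ((a , c) ∷ V)
  walkEdges-tail-⊆ {a} {c} {d} {V = V} w =
    subst (walkEdges V ⊆_) (sym (walkEdges-∷ w))
      (⊆-trans (xs⊆x∷xs _ (c , d)) (xs⊆x∷xs _ (a , c)))

  suffixFrom : ∀ {a d b V} → ShiftedWalk G PM d b V → 0 < multiplicity a (starts V) →
               Σ (List (Fin n × Fin n)) (λ S → ShiftedWalk G PM a b S ×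
                 walkEdges S ⊆ walkEdges V ×
                 (∀ x → multiplicity x (starts S) ≤ multiplicity x (starts V)))
  suffixFrom {a} {d} w@(last _ _) a∈V with d ≟ a
  ... | yes refl = _ , w , ⊆-refl , (λ _ → ≤-refl)
  ... | no _ with () ← a∈V
  suffixFrom {a} {d} w@(step {W = V} _ _ _ w′) a∈V with d ≟ a
  ... | yes refl = _ , w , ⊆-refl , (λ _ → ≤-refl)
  ... | no _ with suffixFrom w′ a∈V
  ... | S , s , S⊆V , fewer =
    S , s , ⊆-trans S⊆V (walkEdges-tail-⊆ w′) ,
    (λ x → ≤-trans (fewer x) (multiplicity-∷ x d (starts V)))

  shortcut : ∀ {a b W} → ShiftedWalk G PM a b W →
             Σ (List (Fin n × Fin n)) (λ V → ShiftedWalk G PM a b V ×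
               DistinctStarts V × walkEdges V ⊆ walkEdges W)
  shortcut {a} w@(last _ _) = _ , w , atMostOnce-∷ a [] refl (λ _ → z≤n) , ⊆-refl
  shortcut {a} (step {c = c} {W = W} adj ¬m m w) with shortcut w
  ... | V , v , distinct , V⊆W with multiplicity a (starts V) in count-a
  ... | zero =
    _ , step adj ¬m m v , atMostOnce-∷ a (starts V) count-a distinct , prepend-⊆
    where
    prepend-⊆ : walkEdges ((a , c) ∷ V) ⊆ walkEdges ((a , c) ∷ W)
    prepend-⊆ = subst₂ _⊆_ (sym (walkEdges-∷ v)) (sym (walkEdges-∷ w)) (∷⁺ʳ _ (∷⁺ʳ _ V⊆W))
  ... | suc _ with suffixFrom v (subst (0 <_) (sym count-a) (s≤s z≤n))
  ... | S , s , S⊆V , fewer =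
    S , s , (λ x → ≤-trans (fewer x) (distinct x)) ,
    ⊆-trans S⊆V (⊆-trans V⊆W (walkEdges-tail-⊆ w))

  -- Every traversal of a matching edge {u,v} is a matching step, which ends
  -- at a re-entry equal to u or v.
  occurrences-≤-reentries : ∀ {a b W} → ShiftedWalk G PM a b W → ∀ {u v} → M u v →
    occurrences u v (walkEdges W) ≤ multiplicity u (reentries W) + multiplicity v (reentries W)
  occurrences-≤-reentries (last _ ¬m) muv =
    subst (_≤ 0) (sym (occurrences-other [] (nonMatching-¬Traverses ¬m muv))) z≤n
  occurrences-≤-reentries (step {a} {c} {d} {W = W} _ ¬m _ w) {u} {v} muv = begin
    occurrences u v (walkEdges ((a , c) ∷ W))
      ≡⟨ cong (occurrences u v) (walkEdges-∷ {a} {c} w) ⟩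
    occurrences u v ((a , c) ∷ (c , d) ∷ walkEdges W)
      ≡⟨ occurrences-other {x = a} {c} ((c , d) ∷ walkEdges W)
           (nonMatching-¬Traverses ¬m muv) ⟩
    occurrences u v ((c , d) ∷ walkEdges W)
      ≤⟨ occurrences-≤-endpoints {x = c} {es = walkEdges W} {reentries W}
           (d ≟ u) (d ≟ v) (occurrences-≤-reentries w muv) ⟩
    multiplicity u (d ∷ reentries W) + multiplicity v (d ∷ reentries W)
      ≡⟨ cong (λ ys → multiplicity u ys + multiplicity v ys) (sym (starts-walk w)) ⟩
    multiplicity u (starts W) + multiplicity v (starts W) ∎
    where open ≤-Reasoning

  distinctStarts⇒Simple : ∀ {a b W} → ShiftedWalk G PM a b W → DistinctStarts W → Simple PM W
  distinctStarts⇒Simple {W = W} w distinct u v muv =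
    ≤-trans (occurrences-≤-reentries w muv) (+-mono-≤ (reentryOnce u) (reentryOnce v))
    where
    reentryOnce : ∀ x → multiplicity x (reentries W) ≤ 1
    reentryOnce x = ≤-trans (reentries≤starts x W) (distinct x)

lemma5p1 : ∀ {n} (G : Graph n) (PM : PerfectMatching G) (a b : Fin n)
             (W : List (Fin n × Fin n)) → ShiftedWalk G PM a b W →
             Σ (List (Fin n × Fin n)) (λ W' →
               ShiftedWalk G PM a b W' × Simple PM W' × W' ⊑ W)
lemma5p1 G PM a b W w =
  let V , v , distinct , V⊆W = shortcut w
  in V , v , distinctStarts⇒Simple v distinct , (λ x y xy∈V → inj₁ (V⊆W xy∈V))
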